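{- Let $n\ge1$, $p$ a prime, $R\subset E_n$, $S\subset E_n$ nonempty, $T=\Phi_R(S)$, and $t\in S$. (1) If $t\notin T$, then $\mathsf{gen}^{(t)}_{R,S}\in\mathcal{C}_{\mathsf{pHa},S}$. (2) If $t\in T$, then $\mathsf{gen}^{(t)}_{R,S}\in\bigcap_{j\in S}\mathcal{C}_{R,S\setminus\{j\}}$.
   Context: $E_n=\{1,\dots,n\}$, indices mod $n$; $e_i$ standard basis of $\mathbb{Z}^n$; $\delta_T^{(m)}=-1$ if $m\in T$, $1$ otherwise; $F^{(d)}_T(x)=\sum_{j=0}^{n-1}p^j\delta_T^{(d+j)}x_{d+j}$. For nonempty $S'\subset E_n$, $\Phi_R(S')$ is the unique $T'\subset E_n$ such that $s-1\in T'\iff s-1\in R$ for all $s\in S'$ and, for every $i$ with $i+1\notin S'$, exactly one of $i,i+1$ lies in $T'$ if $i\notin R$, both or neither if $i\in R$; $\mathcal{C}_{R,S'}=\{x\in\mathbb{Z}^n:F^{(s)}_{\Phi_R(S')}(x)\le0\ \forall s\in S'\}$; and $\mathcal{C}_{R,\emptyset}=\mathbb{Z}^n$. Put $\mathsf{gen}^{(t)}_{R,S}=\delta_T^{(t)}e_t-p\,\delta_R^{(t-1)}e_{t-1}$ and $\mathsf{ha}^{(i)}_{R,S}=-\delta_S^{(i)}e_i-p\delta_R^{(i-1)}e_{i-1}$; $\mathcal{C}_{\mathsf{pHa},S}=\{x\in\mathbb{Z}^n: mx\in\sum_{i\in S}\mathbb{N}\,\mathsf{ha}^{(i)}_{R,S}+\sum_{i\notin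 S}\mathbb{Z}\,\mathsf{ha}^{(i)}_{R,S}\text{ for some } m\ge1\}$. -}

module Defs where

open import Data.Nat as ℕ using (ℕ; NonZero; _^_)
open import Data.Nat.DivMod using (_mod_)
open import Data.Integer as ℤ using (ℤ; +_; -_; _+_; _*_; _-_; _≤_)
open import Data.Fin using (Fin; zero; suc; toℕ; _≟_)
open import Data.Fin.Subset using (Subset; _∈_; _∉_; Nonempty)
open import Data.Bool using (Bool; true; false; if_then_else_)
open import Data.Vec using (lookup)
open import Data.Product using (Σ; ∃; _×_)
open import Relation.Nullary using (¬_; Dec; does)
open import Function.Bundles using (_⇔_)
open import Relation.Binary.PropositionalEquality using (_≡_)

-- Indices: E_n = {1,…,n} is represented by Fin n = {0,…,n-1} (shift by one);
-- all index arithmetic is modulo n.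

_⊕_ : ∀ {n} .{{_ : NonZero n}} → Fin n → ℕ → Fin n
_⊕_ {n} i j = (toℕ i ℕ.+ j) mod n

next : ∀ {n} .{{_ : NonZero n}} → Fin n → Fin n
next i = i ⊕ 1

prev : ∀ {n} .{{_ : NonZero n}} → Fin n → Fin n
prev {n} i = i ⊕ ℕ.pred n

Vecℤ : ℕ → Set
Vecℤ n = Fin n → ℤ

∑ : ∀ {n} → (Fin n → ℤ) → ℤ
∑ {ℕ.zero} f = + 0
∑ {ℕ.suc n} f = f zero + ∑ (λ i → f (suc i))

e : ∀ {n} → Fin n → Vecℤ n
e i k = if does (i ≟ k) then + 1 else + 0

_+ᵥ_ : ∀ {n} → Vecℤ n → Vecℤ n → Vecℤ n
(x +ᵥ y) k = x k + y k

_·ᵥ_ : ∀ {n} → ℤ → Vecℤ n → Vecℤ n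
(c ·ᵥ x) k = c * x k

δ : ∀ {n} → Subset n → Fin n → ℤ
δ T m = if lookup T m then - (+ 1) else + 1

F : ∀ {n} .{{_ : NonZero n}} → ℕ → Subset n → Fin n → Vecℤ n → ℤ
F {n} p T d x = ∑ {n} (λ j → (+ (p ^ toℕ j)) * (δ T (d ⊕ toℕ j) * x (d ⊕ toℕ j)))

-- T' satisfies the characterising property of Φ_R(S')
IsΦ : ∀ {n} .{{_ : NonZero n}} → Subset n → Subset n → Subset n → Set
IsΦ R S' T' =
  (∀ s → s ∈ S' → (prev s ∈ T' ⇔ prev s ∈ R)) ×
  (∀ i → next i ∉ S' →
     (i ∉ R → (i ∈ T' ⇔ next i ∉ T')) ×
     (i ∈ R → (i ∈ T' ⇔ next i ∈ T')))

-- membership in C_{R,S'}: ℤ^n if S' = ∅, otherwise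
-- {x : F^{(s)}_{Φ_R(S')}(x) ≤ 0 ∀ s ∈ S'}  (Φ_R(S') is unique when S' ≠ ∅)
InC : ∀ {n} .{{_ : NonZero n}} → ℕ → Subset n → Subset n → Vecℤ n → Set
InC p R S' x = Nonempty S' →
  ∃ λ T' → IsΦ R S' T' × (∀ s → s ∈ S' → F p T' s x ≤ + 0)

gen : ∀ {n} .{{_ : NonZero n}} → ℕ → Subset n → Subset n → Fin n → Vecℤ n
gen p R T t = (δ T t ·ᵥ e t) +ᵥ ((- (+ p * δ R (prev t))) ·ᵥ e (prev t))

ha : ∀ {n} .{{_ : NonZero n}} → ℕ → Subset n → Subset n → Fin n → Vecℤ n
ha p R S i = ((- δ S i) ·ᵥ e i) +ᵥ ((- (+ p * δ R (prev i))) ·ᵥ e (prev i))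

InCpHa : ∀ {n} .{{_ : NonZero n}} → ℕ → Subset n → Subset n → Vecℤ n → Set
InCpHa {n} p R S x =
  ∃ λ (m : ℕ) → 1 ℕ.≤ m × ∃ λ (c : Fin n → ℤ) →
    (∀ i → i ∈ S → + 0 ≤ c i) ×
    (∀ k → (+ m) * x k ≡ ∑ (λ i → c i * ha p R S i k))

-- If t ∉ T then δ_T(t) = 1 = -δ_S(t) (as t ∈ S), so gen^{(t)} is literally ha^{(t)}.
-- If t ∈ T, let T' = Φ_R(S') for a nonempty S' (it exists: propagate R backwards from
-- each element of S' along the rule "keep the bit if i ∈ R, flip it otherwise").
-- Since gen^{(t)} is supported on t and t-1, F^{(s)}_{T'}(gen^{(t)}) equals
-- -(p^a δ_{T'}(t) + p^{b+1} δ_R(t-1) δ_{T'}(t-1)), where a and b are the offsets of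
-- t and t-1 from s. If s = t then b + 1 = n and the rule of Φ at s gives
-- δ_R(t-1) δ_{T'}(t-1) = 1, so the bracket is δ_{T'}(t) + p^n > 0. Otherwise b + 1 = a,
-- and δ_R(t-1) δ_{T'}(t-1) is 1 or -δ_{T'}(t) according as t ∈ S' or not, so the
-- bracket is p^a times 1 + δ_{T'}(t) or 0.

module Submission where

open import Defs
open import Data.Nat using (ℕ; NonZero)
open import Data.Nat.Primality using (Prime)
open import Data.Fin using (Fin)
open import Data.Fin.Subset using (Subset; _∈_; _∉_; Nonempty; _-_)
open import Data.Product using (_×_)

open import Data.Nat.Base as ℕ using (zero; suc; _<_; _%_; _∸_; _^_; pred; z≤n; s≤s)
import Data.Nat.Properties as ℕₚ
open import Data.Nat.DivMod using (%-distribˡ-+; m%n%n≡m%n; [m+n]%n≡m%n; m<n⇒m%n≡m; m%n<n)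
open import Data.Nat.Primality using (prime⇒nonZero)
open import Data.Integer.Base using (ℤ; +_; -_; _+_; _*_; _≤_; +≤+)
import Data.Integer.Properties as ℤₚ
open import Data.Integer.Tactic.RingSolver using (solve-∀)
open import Data.Fin as Fin using (toℕ; _≟_; punchIn)
open import Data.Fin.Patterns using (0F)
import Data.Fin.Properties as Finₚ
open import Data.Fin.Subset.Properties using (_∈?_)
open import Data.Bool.Base using (Bool; true; false; if_then_else_; not)
open import Data.Vec.Base using (lookup; tabulate)
open import Data.Vec.Properties using ([]=⇒lookup; lookup⇒[]=; lookup∘tabulate)
open import Data.Vec.Functional using (replicate)
open import Data.Product using (∃; _,_; proj₁; proj₂)
open import Data.Sum using (_⊎_; inj₁; inj₂)
open import Data.Empty using (⊥; ⊥-elim)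
open import Function.Base using (_∘_)
open import Function.Bundles using (_⇔_; mk⇔; Equivalence)
open import Relation.Nullary using (yes; no; does)
open import Relation.Nullary.Decidable using (dec-true; dec-false)
open import Relation.Binary.PropositionalEquality
open import Algebra.Properties.Semiring.Sum ℤₚ.+-*-semiring
  using (sum; sum-cong-≗; sum-remove; sum-replicate-zero; ∑-distrib-+; *-distribˡ-sum)

[m%d+n]%d≡[m+n]%d : ∀ m n d .{{_ : NonZero d}} → (m % d ℕ.+ n) % d ≡ (m ℕ.+ n) % d
[m%d+n]%d≡[m+n]%d m n d = begin
  (m % d ℕ.+ n) % d         ≡⟨ %-distribˡ-+ (m % d) n d ⟩
  (m % d % d ℕ.+ n % d) % d ≡⟨ cong (λ x → (x ℕ.+ n % d) % d) (m%n%n≡m%n m d) ⟩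
  (m % d ℕ.+ n % d) % d     ≡⟨ %-distribˡ-+ m n d ⟨
  (m ℕ.+ n) % d             ∎
  where open ≡-Reasoning

module _ {n : ℕ} .{{_ : NonZero n}} where

  toℕ-⊕ : (i : Fin n) (a : ℕ) → toℕ (i ⊕ a) ≡ (toℕ i ℕ.+ a) % n
  toℕ-⊕ i a = Finₚ.toℕ-fromℕ< (m%n<n (toℕ i ℕ.+ a) n)

  ⊕-cong-% : ∀ (i : Fin n) a (j : Fin n) b → (toℕ i ℕ.+ a) % n ≡ (toℕ j ℕ.+ b) % n → i ⊕ a ≡ j ⊕ b
  ⊕-cong-% i a j b eq = Finₚ.toℕ-injective (trans (toℕ-⊕ i a) (trans eq (sym (toℕ-⊕ j b))))

  ⊕-assoc : (i : Fin n) (a b : ℕ) → (i ⊕ a) ⊕ b ≡ i ⊕ (a ℕ.+ b)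
  ⊕-assoc i a b = ⊕-cong-% (i ⊕ a) b i (a ℕ.+ b) (begin
    (toℕ (i ⊕ a) ℕ.+ b) % n       ≡⟨ cong (λ x → (x ℕ.+ b) % n) (toℕ-⊕ i a) ⟩
    ((toℕ i ℕ.+ a) % n ℕ.+ b) % n ≡⟨ [m%d+n]%d≡[m+n]%d (toℕ i ℕ.+ a) b n ⟩
    (toℕ i ℕ.+ a ℕ.+ b) % n       ≡⟨ cong (_% n) (ℕₚ.+-assoc (toℕ i) a b) ⟩
    (toℕ i ℕ.+ (a ℕ.+ b)) % n     ∎)
    where open ≡-Reasoning

  ⊕-identityʳ : (i : Fin n) → i ⊕ 0 ≡ i
  ⊕-identityʳ i = Finₚ.toℕ-injective (begin
    toℕ (i ⊕ 0)         ≡⟨ toℕ-⊕ i 0 ⟩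
    (toℕ i ℕ.+ 0) % n   ≡⟨ cong (_% n) (ℕₚ.+-identityʳ (toℕ i)) ⟩
    toℕ i % n           ≡⟨ m<n⇒m%n≡m (Finₚ.toℕ<n i) ⟩
    toℕ i               ∎)
    where open ≡-Reasoning

  ⊕-+n : (i : Fin n) (a : ℕ) → i ⊕ (a ℕ.+ n) ≡ i ⊕ a
  ⊕-+n i a = ⊕-cong-% i (a ℕ.+ n) i a (begin
    (toℕ i ℕ.+ (a ℕ.+ n)) % n ≡⟨ cong (_% n) (ℕₚ.+-assoc (toℕ i) a n) ⟨
    (toℕ i ℕ.+ a ℕ.+ n) % n   ≡⟨ [m+n]%n≡m%n (toℕ i ℕ.+ a) n ⟩
    (toℕ i ℕ.+ a) % n         ∎)
    where open ≡-Reasoning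

  next-prev : (i : Fin n) → next (prev i) ≡ i
  next-prev i = begin
    (i ⊕ pred n) ⊕ 1    ≡⟨ ⊕-assoc i (pred n) 1 ⟩
    i ⊕ (pred n ℕ.+ 1)  ≡⟨ cong (i ⊕_) (trans (ℕₚ.+-comm (pred n) 1) (ℕₚ.suc-pred n)) ⟩
    i ⊕ (0 ℕ.+ n)       ≡⟨ ⊕-+n i 0 ⟩
    i ⊕ 0               ≡⟨ ⊕-identityʳ i ⟩
    i                   ∎
    where open ≡-Reasoning

  prev-⊕-suc : (i : Fin n) (k : ℕ) → prev (i ⊕ suc k) ≡ i ⊕ k
  prev-⊕-suc i k = begin
    (i ⊕ suc k) ⊕ pred n     ≡⟨ ⊕-assoc i (suc k) (pred n) ⟩
    i ⊕ (suc k ℕ.+ pred n)   ≡⟨ cong (i ⊕_) (ℕₚ.+-suc k (pred n)) ⟨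
    i ⊕ (k ℕ.+ suc (pred n)) ≡⟨ cong (λ m → i ⊕ (k ℕ.+ m)) (ℕₚ.suc-pred n) ⟩
    i ⊕ (k ℕ.+ n)            ≡⟨ ⊕-+n i k ⟩
    i ⊕ k                    ∎
    where open ≡-Reasoning

  offset : Fin n → Fin n → Fin n
  offset s u = u ⊕ (n ∸ toℕ s)

  ∸+-cancel : (s : Fin n) → n ∸ toℕ s ℕ.+ toℕ s ≡ n
  ∸+-cancel s = ℕₚ.m∸n+n≡m (ℕₚ.<⇒≤ (Finₚ.toℕ<n s))

  ⊕-offset : (s u : Fin n) → s ⊕ toℕ (offset s u) ≡ u
  ⊕-offset s u = Finₚ.toℕ-injective (begin
    toℕ (s ⊕ toℕ (offset s u))                   ≡⟨ toℕ-⊕ s _ ⟩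
    (toℕ s ℕ.+ toℕ (offset s u)) % n             ≡⟨ cong (_% n) (ℕₚ.+-comm (toℕ s) _) ⟩
    (toℕ (offset s u) ℕ.+ toℕ s) % n             ≡⟨ cong (λ x → (x ℕ.+ toℕ s) % n) (toℕ-⊕ u _) ⟩
    ((toℕ u ℕ.+ c) % n ℕ.+ toℕ s) % n            ≡⟨ [m%d+n]%d≡[m+n]%d (toℕ u ℕ.+ c) (toℕ s) n ⟩
    (toℕ u ℕ.+ c ℕ.+ toℕ s) % n                  ≡⟨ cong (_% n) (ℕₚ.+-assoc (toℕ u) c (toℕ s)) ⟩
    (toℕ u ℕ.+ (c ℕ.+ toℕ s)) % n                ≡⟨ cong (λ x → (toℕ u ℕ.+ x) % n) (∸+-cancel s) ⟩
    (toℕ u ℕ.+ n) % n                            ≡⟨ [m+n]%n≡m%n (toℕ u) n ⟩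
    toℕ u % n                                    ≡⟨ m<n⇒m%n≡m (Finₚ.toℕ<n u) ⟩
    toℕ u                                        ∎)
    where
    open ≡-Reasoning
    c = n ∸ toℕ s

  toℕ-offset-⊕ : (s : Fin n) {a : ℕ} → a < n → toℕ (offset s (s ⊕ a)) ≡ a
  toℕ-offset-⊕ s {a} a<n = begin
    toℕ ((s ⊕ a) ⊕ c)            ≡⟨ cong toℕ (⊕-assoc s a c) ⟩
    toℕ (s ⊕ (a ℕ.+ c))          ≡⟨ toℕ-⊕ s (a ℕ.+ c) ⟩
    (toℕ s ℕ.+ (a ℕ.+ c)) % n    ≡⟨ cong (_% n) (ℕₚ.+-comm (toℕ s) (a ℕ.+ c)) ⟩
    (a ℕ.+ c ℕ.+ toℕ s) % n      ≡⟨ cong (_% n) (ℕₚ.+-assoc a c (toℕ s)) ⟩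
    (a ℕ.+ (c ℕ.+ toℕ s)) % n    ≡⟨ cong (λ x → (a ℕ.+ x) % n) (∸+-cancel s) ⟩
    (a ℕ.+ n) % n                ≡⟨ [m+n]%n≡m%n a n ⟩
    a % n                        ≡⟨ m<n⇒m%n≡m a<n ⟩
    a                            ∎
    where
    open ≡-Reasoning
    c = n ∸ toℕ s

  offset-⊕ : (s j : Fin n) → offset s (s ⊕ toℕ j) ≡ j
  offset-⊕ s j = Finₚ.toℕ-injective (toℕ-offset-⊕ s (Finₚ.toℕ<n j))

  toℕ-offset-self : (s : Fin n) → toℕ (offset s s) ≡ 0
  toℕ-offset-self s = trans (cong (toℕ ∘ offset s) (sym (⊕-identityʳ s))) (toℕ-offset-⊕ s (ℕ.>-nonZero⁻¹ n))

  toℕ-offset-prev-self : (s : Fin n) → toℕ (offset s (prev s)) ≡ pred n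
  toℕ-offset-prev-self s = toℕ-offset-⊕ s (ℕₚ.≤-reflexive (ℕₚ.suc-pred n))

  offset-cases : (s t : Fin n) →
    s ≡ t ⊎ ∃ λ k → toℕ (offset s t) ≡ suc k × toℕ (offset s (prev t)) ≡ k
  offset-cases s t with toℕ (offset s t) in a≡ | ⊕-offset s t
  ... | zero  | s⊕0≡t = inj₁ (trans (sym (⊕-identityʳ s)) s⊕0≡t)
  ... | suc k | s⊕k+1≡t = inj₂ (k , refl , (begin
    toℕ (offset s (prev t))        ≡⟨ cong (toℕ ∘ offset s ∘ prev) s⊕k+1≡t ⟨
    toℕ (offset s (prev (s ⊕ suc k))) ≡⟨ cong (toℕ ∘ offset s) (prev-⊕-suc s k) ⟩
    toℕ (offset s (s ⊕ k))         ≡⟨ toℕ-offset-⊕ s k<n ⟩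
    k                              ∎))
    where
    open ≡-Reasoning
    k<n : k < n
    k<n = ℕₚ.<-trans (ℕₚ.n<1+n k) (subst (_< n) a≡ (Finₚ.toℕ<n (offset s t)))

∑≡sum : ∀ {n} (f : Fin n → ℤ) → ∑ f ≡ sum f
∑≡sum {zero}  f = refl
∑≡sum {suc n} f = cong (_+_ (f 0F)) (∑≡sum (f ∘ Fin.suc))

∑-cong : ∀ {n} {f g : Fin n → ℤ} → (∀ j → f j ≡ g j) → ∑ f ≡ ∑ g
∑-cong {f = f} {g} f≗g = trans (∑≡sum f) (trans (sum-cong-≗ f≗g) (sym (∑≡sum g)))

∑-+ : ∀ {n} (f g : Fin n → ℤ) → ∑ (λ j → f j + g j) ≡ ∑ f + ∑ g
∑-+ f g = trans (∑≡sum (λ j → f j + g j)) (trans (∑-distrib-+ f g) (sym (cong₂ _+_ (∑≡sum f) (∑≡sum g))))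

∑-* : ∀ {n} (c : ℤ) (f : Fin n → ℤ) → ∑ (λ j → c * f j) ≡ c * ∑ f
∑-* c f = trans (∑≡sum (λ j → c * f j)) (trans (sym (*-distribˡ-sum c f)) (cong (c *_) (sym (∑≡sum f))))

∑-single : ∀ {n} (f : Fin n → ℤ) (i : Fin n) → (∀ j → j ≢ i → f j ≡ + 0) → ∑ f ≡ f i
∑-single {suc n} f i f≡0 = begin
  ∑ f                           ≡⟨ ∑≡sum f ⟩
  sum f                         ≡⟨ sum-remove {i = i} f ⟩
  f i + sum (f ∘ punchIn i)     ≡⟨ cong (_+_ (f i)) (sum-cong-≗ (λ j → f≡0 (punchIn i j) (Finₚ.punchInᵢ≢i i j))) ⟩
  f i + sum (replicate n (+ 0)) ≡⟨ cong (_+_ (f i)) (sum-replicate-zero n) ⟩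
  f i + + 0                     ≡⟨ ℤₚ.+-identityʳ (f i) ⟩
  f i                           ∎
  where open ≡-Reasoning

e-diag : ∀ {n} (u : Fin n) → e u u ≡ + 1
e-diag u rewrite dec-true (u ≟ u) refl = refl

e-offdiag : ∀ {n} {u v : Fin n} → u ≢ v → e u v ≡ + 0
e-offdiag {u = u} {v} u≢v rewrite dec-false (u ≟ v) u≢v = refl

e-nonNeg : ∀ {n} (u v : Fin n) → + 0 ≤ e u v
e-nonNeg u v with does (u ≟ v)
... | true  = +≤+ z≤n
... | false = +≤+ z≤n

module _ {n : ℕ} {P : Subset n} {x : Fin n} where

  ∉⇒lookup≡false : x ∉ P → lookup P x ≡ false
  ∉⇒lookup≡false x∉P with lookup P x in eq
  ... | true  = ⊥-elim (x∉P (lookup⇒[]= x P eq))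
  ... | false = refl

  δ-∈ : x ∈ P → δ P x ≡ - + 1
  δ-∈ x∈P rewrite []=⇒lookup x∈P = refl

  δ-∉ : x ∉ P → δ P x ≡ + 1
  δ-∉ x∉P rewrite ∉⇒lookup≡false x∉P = refl

  δ*δ≡1 : δ P x * δ P x ≡ + 1
  δ*δ≡1 with x ∈? P
  ... | yes x∈P rewrite δ-∈ x∈P = refl
  ... | no  x∉P rewrite δ-∉ x∉P = refl

0≤δ+m : ∀ {n} (P : Subset n) (x : Fin n) m .{{_ : NonZero m}} → + 0 ≤ δ P x + + m
0≤δ+m P x (suc m) with x ∈? P
... | yes x∈P rewrite δ-∈ x∈P = +≤+ z≤n
... | no  x∉P rewrite δ-∉ x∉P = +≤+ z≤n

module _ {n : ℕ} {P Q : Subset n} {x y : Fin n} where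

  δ-cong : (x ∈ P ⇔ y ∈ Q) → δ P x ≡ δ Q y
  δ-cong x∈P⇔y∈Q with x ∈? P
  ... | yes x∈P = trans (δ-∈ x∈P) (sym (δ-∈ (Equivalence.to x∈P⇔y∈Q x∈P)))
  ... | no  x∉P = trans (δ-∉ x∉P) (sym (δ-∉ (x∉P ∘ Equivalence.from x∈P⇔y∈Q)))

  δ-flip : (x ∈ P ⇔ y ∉ Q) → δ P x ≡ - δ Q y
  δ-flip x∈P⇔y∉Q with y ∈? Q
  ... | yes y∈Q rewrite δ-∈ y∈Q = δ-∉ (λ x∈P → Equivalence.to x∈P⇔y∉Q x∈P y∈Q)
  ... | no  y∉Q rewrite δ-∉ y∉Q = δ-∈ (Equivalence.from x∈P⇔y∉Q y∉Q)

  lookup-≡⇒⇔ : lookup P x ≡ lookup Q y → (x ∈ P ⇔ y ∈ Q)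
  lookup-≡⇒⇔ eq = mk⇔ (λ x∈P → lookup⇒[]= y Q (trans (sym eq) ([]=⇒lookup x∈P)))
                      (λ y∈Q → lookup⇒[]= x P (trans eq ([]=⇒lookup y∈Q)))

  lookup-≡not⇒⇔ : lookup P x ≡ not (lookup Q y) → (x ∈ P ⇔ y ∉ Q)
  lookup-≡not⇒⇔ eq = mk⇔ not-both (λ y∉Q → lookup⇒[]= x P (trans eq (cong not (∉⇒lookup≡false y∉Q))))
    where
    not-both : x ∈ P → y ∈ Q → ⊥
    not-both x∈P y∈Q with trans (sym ([]=⇒lookup x∈P)) (trans eq (cong not ([]=⇒lookup y∈Q)))
    ... | ()

module _ {n : ℕ} .{{_ : NonZero n}} (p : ℕ) (T' : Subset n) (s : Fin n) where

  summand : Vecℤ n → Fin n → ℤ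
  summand x j = + (p ^ toℕ j) * (δ T' (s ⊕ toℕ j) * x (s ⊕ toℕ j))

  F-+ᵥ : (x y : Vecℤ n) → F p T' s (x +ᵥ y) ≡ F p T' s x + F p T' s y
  F-+ᵥ x y = trans (∑-cong {n} (λ j → distrib (+ (p ^ toℕ j)) (δ T' (s ⊕ toℕ j)) (x (s ⊕ toℕ j)) (y (s ⊕ toℕ j))))
                   (∑-+ (summand x) (summand y))
    where
    distrib : ∀ (w d a b : ℤ) → w * (d * (a + b)) ≡ w * (d * a) + w * (d * b)
    distrib = solve-∀

  F-·ᵥ : (c : ℤ) (x : Vecℤ n) → F p T' s (c ·ᵥ x) ≡ c * F p T' s x
  F-·ᵥ c x = trans (∑-cong {n} (λ j → pull (+ (p ^ toℕ j)) (δ T' (s ⊕ toℕ j)) c (x (s ⊕ toℕ j))))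
                   (∑-* c (summand x))
    where
    pull : ∀ (w d c a : ℤ) → w * (d * (c * a)) ≡ c * (w * (d * a))
    pull = solve-∀

  F-e : (u : Fin n) → F p T' s (e u) ≡ + (p ^ toℕ (offset s u)) * δ T' u
  F-e u = begin
    F p T' s (e u)                                    ≡⟨ ∑-single (summand (e u)) (offset s u) vanish ⟩
    + (p ^ a) * (δ T' (s ⊕ a) * e u (s ⊕ a))          ≡⟨ cong (λ v → + (p ^ a) * (δ T' v * e u v)) (⊕-offset s u) ⟩
    + (p ^ a) * (δ T' u * e u u)                      ≡⟨ cong (λ z → + (p ^ a) * (δ T' u * z)) (e-diag u) ⟩
    + (p ^ a) * (δ T' u * + 1)                        ≡⟨ cong (+ (p ^ a) *_) (ℤₚ.*-identityʳ (δ T' u)) ⟩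
    + (p ^ a) * δ T' u                                ∎
    where
    open ≡-Reasoning
    a = toℕ (offset s u)
    vanish : ∀ j → j ≢ offset s u → summand (e u) j ≡ + 0
    vanish j j≢ rewrite e-offdiag (λ u≡ → j≢ (trans (sym (offset-⊕ s j)) (cong (offset s) (sym u≡))))
                      | ℤₚ.*-zeroʳ (δ T' (s ⊕ toℕ j)) = ℤₚ.*-zeroʳ (+ (p ^ toℕ j))

  F-gen : (R T : Subset n) (t : Fin n) →
    F p T' s (gen p R T t) ≡ δ T t * (+ (p ^ toℕ (offset s t)) * δ T' t)
                             + - (+ p * δ R (prev t)) * (+ (p ^ toℕ (offset s (prev t))) * δ T' (prev t))
  F-gen R T t = begin
    F p T' s ((α ·ᵥ e t) +ᵥ (β ·ᵥ e (prev t)))        ≡⟨ F-+ᵥ (α ·ᵥ e t) (β ·ᵥ e (prev t)) ⟩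
    F p T' s (α ·ᵥ e t) + F p T' s (β ·ᵥ e (prev t))  ≡⟨ cong₂ _+_ (F-·ᵥ α (e t)) (F-·ᵥ β (e (prev t))) ⟩
    α * F p T' s (e t) + β * F p T' s (e (prev t))    ≡⟨ cong₂ (λ x y → α * x + β * y) (F-e t) (F-e (prev t)) ⟩
    _                                                  ∎
    where
    open ≡-Reasoning
    α = δ T t
    β = - (+ p * δ R (prev t))

  F-gen-∈ : (R T : Subset n) {t : Fin n} → t ∈ T →
    F p T' s (gen p R T t) ≡ - (+ (p ^ toℕ (offset s t)) * δ T' t
                               + + (p ^ suc (toℕ (offset s (prev t)))) * (δ R (prev t) * δ T' (prev t)))
  F-gen-∈ R T {t} t∈T = begin
    F p T' s (gen p R T t)                              ≡⟨ F-gen R T t ⟩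
    δ T t * (A * σ) + - (+ p * ρ) * (+ (p ^ b) * τ)     ≡⟨ cong (λ d → d * (A * σ) + - (+ p * ρ) * (+ (p ^ b) * τ)) (δ-∈ t∈T) ⟩
    - + 1 * (A * σ) + - (+ p * ρ) * (+ (p ^ b) * τ)     ≡⟨ collect A (+ p) (+ (p ^ b)) σ ρ τ ⟩
    - (A * σ + + p * + (p ^ b) * (ρ * τ))               ≡⟨ cong (λ P → - (A * σ + P * (ρ * τ))) (ℤₚ.pos-* p (p ^ b)) ⟨
    - (A * σ + + (p ^ suc b) * (ρ * τ))                 ∎
    where
    open ≡-Reasoning
    A = + (p ^ toℕ (offset s t))
    b = toℕ (offset s (prev t))
    σ = δ T' t
    ρ = δ R (prev t)
    τ = δ T' (prev t)
    collect : ∀ (A P Q σ ρ τ : ℤ) → - + 1 * (A * σ) + - (P * ρ) * (Q * τ) ≡ - (A * σ + P * Q * (ρ * τ))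
    collect = solve-∀

module _ {n : ℕ} .{{_ : NonZero n}} {R S' T' : Subset n} (φ : IsΦ R S' T') where

  cross-sign-∈ : ∀ {t} → t ∈ S' → δ R (prev t) * δ T' (prev t) ≡ + 1
  cross-sign-∈ {t} t∈S' = trans (cong (δ R (prev t) *_) (δ-cong (proj₁ φ t t∈S'))) (δ*δ≡1 {P = R})

  cross-sign-∉ : ∀ {t} → t ∉ S' → δ R (prev t) * δ T' (prev t) ≡ - δ T' t
  cross-sign-∉ {t} t∉S' with proj₂ φ (prev t) (subst (_∉ S') (sym (next-prev t)) t∉S') | prev t ∈? R
  ... | flips , _ | no t-1∉R rewrite δ-∉ t-1∉R =
    trans (ℤₚ.*-identityˡ _) (trans (δ-flip (flips t-1∉R)) (cong (-_ ∘ δ T') (next-prev t)))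
  ... | _ , keeps | yes t-1∈R rewrite δ-∈ t-1∈R =
    trans (ℤₚ.-1*i≡-i _) (cong -_ (trans (δ-cong (keeps t-1∈R)) (cong (δ T') (next-prev t))))

  cross-sum-nonNeg : (t : Fin n) → + 0 ≤ δ T' t + δ R (prev t) * δ T' (prev t)
  cross-sum-nonNeg t with t ∈? S'
  ... | yes t∈S' rewrite cross-sign-∈ t∈S' = 0≤δ+m T' t 1
  ... | no  t∉S' rewrite cross-sign-∉ t∉S' | ℤₚ.+-inverseʳ (δ T' t) = +≤+ z≤n

  F-gen-nonPos : ∀ p .{{_ : NonZero p}} {T : Subset n} {s t : Fin n} → s ∈ S' → t ∈ T →
                 F p T' s (gen p R T t) ≤ + 0
  F-gen-nonPos p {T} {s} {t} s∈S' t∈T =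
    subst (_≤ + 0) (sym (F-gen-∈ p T' s R T t∈T)) (ℤₚ.neg-mono-≤ (bracket-nonNeg (offset-cases s t)))
    where
    bracket-nonNeg : s ≡ t ⊎ ∃ (λ k → toℕ (offset s t) ≡ suc k × toℕ (offset s (prev t)) ≡ k) →
      + 0 ≤ + (p ^ toℕ (offset s t)) * δ T' t
            + + (p ^ suc (toℕ (offset s (prev t)))) * (δ R (prev t) * δ T' (prev t))
    bracket-nonNeg (inj₁ refl)
      rewrite toℕ-offset-self s | toℕ-offset-prev-self s | cross-sign-∈ s∈S'
            | ℤₚ.*-identityˡ (δ T' s) | ℤₚ.*-identityʳ (+ (p ^ suc (pred n))) =
      0≤δ+m T' s (p ^ suc (pred n)) {{ℕₚ.m^n≢0 p (suc (pred n))}}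
    bracket-nonNeg (inj₂ (k , a≡ , b≡))
      rewrite a≡ | b≡ | sym (ℤₚ.*-distribˡ-+ (+ (p ^ suc k)) (δ T' t) (δ R (prev t) * δ T' (prev t))) =
      subst (_≤ P * _) (ℤₚ.*-zeroʳ P) (ℤₚ.*-monoˡ-≤-nonNeg P (cross-sum-nonNeg t))
      where P = + (p ^ suc k)

propagate : Bool → Bool → Bool
propagate r b = if r then b else not b

⇔-propagate : ∀ {n} {R T : Subset n} {i j : Fin n} →
  lookup T i ≡ propagate (lookup R i) (lookup T j) →
  (i ∉ R → (i ∈ T ⇔ j ∉ T)) × (i ∈ R → (i ∈ T ⇔ j ∈ T))
⇔-propagate {R = R} {T} {i} {j} eq =
    (λ i∉R → lookup-≡not⇒⇔ (trans eq (cong (λ r → propagate r (lookup T j)) (∉⇒lookup≡false i∉R))))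
  , (λ i∈R → lookup-≡⇒⇔ (trans eq (cong (λ r → propagate r (lookup T j)) ([]=⇒lookup i∈R))))

module Φ-construction {n : ℕ} .{{_ : NonZero n}} (R S' : Subset n) where

  -- approx f k applies the rule of Φ walking forward from k for at most f steps (false
  -- if no element of S' is met); it stabilises once some element of S' is within reach.
  approx : ℕ → Fin n → Bool
  approx zero    k = false
  approx (suc f) k = if lookup S' (next k) then lookup R k else propagate (lookup R k) (approx f (next k))

  approx-stable : ∀ {o f} (k : Fin n) → o < f → lookup S' (next k ⊕ o) ≡ true → approx f k ≡ approx (suc f) k
  approx-stable {zero} {suc f} k _ hit rewrite ⊕-identityʳ (next k) | hit = refl
  approx-stable {suc o} {suc f} k (s≤s o<f) hit with lookup S' (next k)
  ... | true  = refl
  ... | false = cong (propagate (lookup R k))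
                     (approx-stable (next k) o<f (subst (λ v → lookup S' v ≡ true) (sym (⊕-assoc (next k) 1 o)) hit))

  Φ : Subset n
  Φ = tabulate (approx (2 ℕ.+ n))

  lookup-Φ-prev : ∀ {s} → s ∈ S' → lookup Φ (prev s) ≡ lookup R (prev s)
  lookup-Φ-prev {s} s∈S' rewrite lookup∘tabulate (approx (2 ℕ.+ n)) (prev s) | next-prev s | []=⇒lookup s∈S' = refl

  lookup-Φ-step : Nonempty S' → ∀ {i} → next i ∉ S' → lookup Φ i ≡ propagate (lookup R i) (lookup Φ (next i))
  lookup-Φ-step (s , s∈S') {i} i+1∉S'
    rewrite lookup∘tabulate (approx (2 ℕ.+ n)) i | lookup∘tabulate (approx (2 ℕ.+ n)) (next i)
          | ∉⇒lookup≡false i+1∉S' =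
    cong (propagate (lookup R i)) (approx-stable (next i) (ℕₚ.m<n⇒m<1+n (Finₚ.toℕ<n o)) hit)
    where
    o = offset (next (next i)) s
    hit : lookup S' (next (next i) ⊕ toℕ o) ≡ true
    hit = trans (cong (lookup S') (⊕-offset (next (next i)) s)) ([]=⇒lookup s∈S')

  Φ-isΦ : Nonempty S' → IsΦ R S' Φ
  Φ-isΦ ne = (λ s s∈S' → lookup-≡⇒⇔ (lookup-Φ-prev s∈S'))
           , (λ i i+1∉S' → ⇔-propagate (lookup-Φ-step ne i+1∉S'))

gen-∈C : ∀ {n} .{{_ : NonZero n}} p .{{_ : NonZero p}} (R S' T : Subset n) {t : Fin n} → t ∈ T →
         InC p R S' (gen p R T t)
gen-∈C p R S' T t∈T ne = Φ , Φ-isΦ ne , λ s s∈S' → F-gen-nonPos (Φ-isΦ ne) p s∈S' t∈T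
  where open Φ-construction R S'

gen≗ha : ∀ {n} .{{_ : NonZero n}} p (R S T : Subset n) {t : Fin n} → t ∈ S → t ∉ T →
         ∀ k → gen p R T t k ≡ ha p R S t k
gen≗ha p R S T t∈S t∉T k rewrite δ-∉ t∉T | δ-∈ t∈S = refl

gen-∈CpHa : ∀ {n} .{{_ : NonZero n}} p (R S T : Subset n) {t : Fin n} → t ∈ S → t ∉ T →
            InCpHa p R S (gen p R T t)
gen-∈CpHa p R S T {t} t∈S t∉T = 1 , ℕₚ.≤-refl , e t , (λ i _ → e-nonNeg t i) , expansion
  where
  open ≡-Reasoning
  expansion : ∀ k → + 1 * gen p R T t k ≡ ∑ (λ i → e t i * ha p R S i k)
  expansion k = begin
    + 1 * gen p R T t k               ≡⟨ ℤₚ.*-identityˡ _ ⟩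
    gen p R T t k                     ≡⟨ gen≗ha p R S T t∈S t∉T k ⟩
    ha p R S t k                      ≡⟨ ℤₚ.*-identityˡ _ ⟨
    + 1 * ha p R S t k                ≡⟨ cong (_* ha p R S t k) (e-diag t) ⟨
    e t t * ha p R S t k              ≡⟨ ∑-single (λ i → e t i * ha p R S i k) t vanish ⟨
    ∑ (λ i → e t i * ha p R S i k)    ∎
    where
    vanish : ∀ i → i ≢ t → e t i * ha p R S i k ≡ + 0
    vanish i i≢t = trans (cong (_* ha p R S i k) (e-offdiag (i≢t ∘ sym))) (ℤₚ.*-zeroˡ (ha p R S i k))

proposition5p8p1 : (n : ℕ) .{{_ : NonZero n}} (p : ℕ) → Prime p →
    (R S T : Subset n) → Nonempty S → IsΦ R S T → (t : Fin n) → t ∈ S →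
    (t ∉ T → InCpHa p R S (gen p R T t)) ×
    (t ∈ T → ∀ j → j ∈ S → InC p R (S - j) (gen p R T t))
proposition5p8p1 n p p-prime R S T _ _ t t∈S =
    gen-∈CpHa p R S T t∈S
  , λ t∈T j _ → gen-∈C p {{prime⇒nonZero p-prime}} R (S - j) T t∈T
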